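{- Let $G=(V,E)$ be a finite digraph with minimum out-degree at least $d$ and maximum in-degree at most $e^{\frac{d-1}{16}-1}/d$. Then for every pair of distinct vertices $v_1,v_2\in V$ there exists an $r$-friendly partition of $G$ separating $v_1$ and $v_2$, where $r=\frac{d-1}{4}+1$.
   Context: Digraphs have no loops and no parallel arcs in the same direction. For $r>0$, an $r$-friendly partition of $G=(V,E)$ is a partition $\{V_1,V_2\}$ of $V$ into two nonempty sets such that every vertex has at least $r$ out-neighbors in its own part; it separates $v_1,v_2$ if they lie in different parts. $e$ is Euler's number. -}

module Defs where

open import Data.Nat using (ℕ; zero; suc; _+_; _*_; _^_; _≤_; _!)
open import Data.Integer using (ℤ; +_; -[1+_])
open import Data.Bool using (Bool; true; false; if_then_else_; _∧_)
open import Data.Fin using (Fin)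
open import Data.List using (List; map)
open import Data.Nat.ListAction using (sum)
open import Data.List using () renaming (allFin to allFinL)
open import Data.Product using (Σ; ∃; _×_)
open import Relation.Binary.PropositionalEquality using (_≡_; _≢_)

-- A finite digraph on vertex set Fin n. Arcs are given by a Boolean
-- adjacency relation (so no parallel arcs in the same direction),
-- and there are no loops.
record Digraph : Set where
  field
    n      : ℕ
    arc    : Fin n → Fin n → Bool
    noLoop : (v : Fin n) → arc v v ≡ false
open Digraph public

count : {n : ℕ} → (Fin n → Bool) → ℕ
count {n} P = sum (map (λ w → if P w then 1 else 0) (allFinL n))

outdeg : (G : Digraph) → Fin (n G) → ℕ
outdeg G v = count (λ w → arc G v w)

indeg : (G : Digraph) → Fin (n G) → ℕ
indeg G v = count (λ w → arc G w v)

-- A partition {V₁,V₂} of V is encoded by its indicator p : V → Bool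
-- (V₁ = p⁻¹ true, V₂ = p⁻¹ false); both parts must be nonempty.
NonemptyParts : (G : Digraph) → (Fin (n G) → Bool) → Set
NonemptyParts G p = (∃ λ v → p v ≡ true) × (∃ λ v → p v ≡ false)

_==_ : Bool → Bool → Bool
true  == true  = true
false == false = true
_     == _     = false

ownOut : (G : Digraph) → (Fin (n G) → Bool) → Fin (n G) → ℕ
ownOut G p v = count (λ w → arc G v w ∧ (p w == p v))

-- r-friendly partition for the rational r = a / 4 (a > 0):
-- every vertex has at least a/4 out-neighbours in its own part,
-- i.e. a ≤ 4 * (#own out-neighbours).
FriendlyQuarter : (G : Digraph) → ℕ → (Fin (n G) → Bool) → Set
FriendlyQuarter G a p =
  NonemptyParts G p × ((v : Fin (n G)) → a ≤ 4 * ownOut G p v)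

-- Exponential series, scaled: S m k = Σ_{j=0}^{k} m^j * k!/j!,
-- so S m k / k! is the k-th partial sum of e^m = Σ_j m^j / j!.
S : ℕ → ℕ → ℕ
S m zero    = 1
S m (suc k) = suc k * S m k + m ^ suc k

-- N ≤ e^z for a natural N and an integer z, with e^m := Σ_j m^j/j!.
--  z = m ≥ 0 : N ≤ e^m  iff  N ≤ some partial sum (partial sums increase to e^m,
--              and e^m is irrational for m ≥ 1, equal to S m 0 = 1 for m = 0).
--  z = -(j+1): N ≤ e^{-(j+1)}  iff  N * e^{j+1} ≤ 1  iff  every partial sum
--              of N * e^{j+1} is ≤ 1.
LeExp : ℕ → ℤ → Set
LeExp N (+ m)     = ∃ λ k → N * (k !) ≤ S m k
LeExp N -[1+ j ]  = (k : ℕ) → N * S (suc j) k ≤ k !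

{-# OPTIONS --safe #-}
-- Colour the vertices independently and uniformly at random, except that v₁ and v₂ are pinned to
-- different colours. For each vertex v fix a set F v of N = d − 2 out-neighbours other than v₁ and v₂,
-- and call v bad if fewer than t = ⌈(d + 3)/4⌉ of them share the colour of v. That number is binomial,
-- so a Chernoff-type estimate gives P(v bad) ≤ 2 · 3^t · (2/3)^N. Badness of v depends only on the
-- colours of v and F v, so it is independent of all bad events but at most (N + 1)(Δ + 1) of them,
-- Δ being the maximal in-degree. The Lovász Local Lemma, proved here by counting assignments, then
-- yields a colouring without bad vertices as soon as 8 (N + 1)(Δ + 1) · 3^t · 2^N ≤ 3^N.
-- Bounding the partial sums of the exponential series turns the hypothesis into
-- (Δ d)^16 ≤ (2m + 3) · 4^m with m = d − 17 (for d < 17 it would force Δ = 0), and Δ ≥ d forces m ≥ 100.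
-- Raised to the 16th power, the required inequality reduces to (2m + 3) · 2^(18m + 304) ≤ 3^(12m + 148),
-- which holds from m = 100 on by induction.
module Submission where

open import Defs
open import Data.Nat
  using ( ℕ; zero; suc; _+_; _*_; _^_; _∸_; _≤_; _<_; s≤s; z≤n; _<ᵇ_; _<?_; _≤?_; _!; _/_; _%_
        ; NonZero; >-nonZero; >-nonZero⁻¹)
open import Data.Nat.Properties hiding (_≟_)
open import Data.Nat.DivMod using (m≡m%n+[m/n]*n; m%n<n)
open import Data.Nat.Tactic.RingSolver using (solve-∀)
import Data.Nat.ListAction as List
open import Data.Integer as ℤ using (_⊖_; -[1+_]; sign)
open import Data.Integer.Properties using (⊖-≥; sign-⊖-<)
import Data.Sign as Sign
open import Data.Bool using (Bool; true; false; T; not; _∧_; _∨_; if_then_else_)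
open import Data.Bool.Properties using (T-≡; T-∧; T-∨; ∧-comm)
open import Function.Bundles using (module Equivalence)
open Equivalence using (to; from)
open import Data.Fin using (Fin; zero; suc; _≟_)
import Data.Fin.Properties as Fin
open import Data.Vec.Functional using ([]; _∷_)
open import Data.List using (allFin; tabulate)
open import Data.List.Properties using (map-tabulate)
open import Data.Product using (Σ; ∃; _×_; _,_; proj₁; proj₂)
open import Data.Sum using (_⊎_; inj₁; inj₂)
open import Data.Empty using (⊥-elim)
open import Function using (_∘_; id)
open import Relation.Nullary using (¬_; yes; no)
open import Relation.Nullary.Decidable using (⌊_⌋; toWitness; fromWitness)
open import Relation.Binary.PropositionalEquality
open import Algebra.Properties.CommutativeMonoid.Sum +-0-commutativeMonoid
  using (sum; sum-syntax; sum-cong-≗; ∑-distrib-+; ∑-comm)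
open import Algebra.Properties.CommutativeSemigroup +-commutativeSemigroup
  using () renaming (interchange to +-interchange)
open import Algebra.Properties.CommutativeSemigroup *-commutativeSemigroup
  using () renaming (interchange to *-interchange)
open import Algebra.Properties.Semiring.Sum +-*-semiring using (*-distribˡ-sum; *-distribʳ-sum)

private variable
  Ω : Set

_∩_ _∪_ : (Ω → Bool) → (Ω → Bool) → Ω → Bool
(P ∩ Q) x = P x ∧ Q x
(P ∪ Q) x = P x ∨ Q x

∁ : (Ω → Bool) → Ω → Bool
∁ P x = not (P x)

_⊆_ : (Ω → Bool) → (Ω → Bool) → Set
P ⊆ Q = ∀ x → T (P x) → T (Q x)

⁅_⁆ : ∀ {n} → Fin n → Fin n → Bool
⁅ i ⁆ j = ⌊ i ≟ j ⌋

infixr 7 _∩_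
infixr 6 _∪_
infix 4 _⊆_

¬T⇒T-not : ∀ {b} → ¬ T b → T (not b)
¬T⇒T-not {false} _  = _
¬T⇒T-not {true}  ¬t = ¬t _

T-not⇒¬T : ∀ {b} → T (not b) → ¬ T b
T-not⇒¬T {false} _ ()

¬T⇒≡false : ∀ {b} → ¬ T b → b ≡ false
¬T⇒≡false {false} _  = refl
¬T⇒≡false {true}  ¬t = ⊥-elim (¬t _)

𝟙 : Bool → ℕ
𝟙 b = if b then 1 else 0

𝟙-mono : ∀ {a b} → (T a → T b) → 𝟙 a ≤ 𝟙 b
𝟙-mono {false} _ = z≤n
𝟙-mono {true} {true}  _ = ≤-refl
𝟙-mono {true} {false} h = ⊥-elim (h _)

𝟙≤1 : ∀ b → 𝟙 b ≤ 1
𝟙≤1 false = z≤n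
𝟙≤1 true  = ≤-refl

𝟙-split : ∀ a b → 𝟙 a ≡ 𝟙 (a ∧ b) + 𝟙 (a ∧ not b)
𝟙-split false _     = refl
𝟙-split true  false = refl
𝟙-split true  true  = refl

𝟙-∨ : ∀ a b → 𝟙 (a ∨ b) ≤ 𝟙 a + 𝟙 b
𝟙-∨ false _ = ≤-refl
𝟙-∨ true  b = m≤m+n 1 (𝟙 b)

𝟙-∧ : ∀ a b → 𝟙 (a ∧ b) ≡ 𝟙 a * 𝟙 b
𝟙-∧ false _ = refl
𝟙-∧ true  b = sym (+-identityʳ (𝟙 b))

^-distribʳ-* : ∀ x y n → (x * y) ^ n ≡ x ^ n * y ^ n
^-distribʳ-* x y zero    = refl
^-distribʳ-* x y (suc n) = trans (cong (x * y *_) (^-distribʳ-* x y n)) (*-interchange x y (x ^ n) (y ^ n))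

^-merge₃ : ∀ b x y z → b ^ x * b ^ y * b ^ z ≡ b ^ (x + y + z)
^-merge₃ b x y z = sym (trans (^-distribˡ-+-* b (x + y) z) (cong (_* b ^ z) (^-distribˡ-+-* b x y)))

^-cancelʳ-≤ : ∀ n .{{_ : NonZero n}} a b → a ^ n ≤ b ^ n → a ≤ b
^-cancelʳ-≤ n a b aⁿ≤bⁿ = ≮⇒≥ (λ b<a → <⇒≱ (^-monoˡ-< n b<a) aⁿ≤bⁿ)

-- Counting subsets of Fin n

∑-mono : ∀ {n} {f g : Fin n → ℕ} → (∀ i → f i ≤ g i) → sum f ≤ sum g
∑-mono {zero}  _   = z≤n
∑-mono {suc n} f≤g = +-mono-≤ (f≤g zero) (∑-mono (f≤g ∘ suc))

∑-const : ∀ n c → ∑[ i < n ] c ≡ n * c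
∑-const zero    c = refl
∑-const (suc n) c = cong (c +_) (∑-const n c)

∣_∣ : ∀ {n} → (Fin n → Bool) → ℕ
∣ P ∣ = ∑[ i < _ ] 𝟙 (P i)

count≡∣∣ : ∀ {n} (P : Fin n → Bool) → count P ≡ ∣ P ∣
count≡∣∣ {n} P = begin
  List.sum (Data.List.map (𝟙 ∘ P) (allFin n)) ≡⟨ cong List.sum (map-tabulate id (𝟙 ∘ P)) ⟩
  List.sum (tabulate (𝟙 ∘ P))                 ≡⟨ listSum-tabulate (𝟙 ∘ P) ⟩
  ∣ P ∣                                         ∎
  where
  open ≡-Reasoning
  listSum-tabulate : ∀ {n} (f : Fin n → ℕ) → List.sum (tabulate f) ≡ sum f
  listSum-tabulate {zero}  f = refl
  listSum-tabulate {suc n} f = cong (f zero +_) (listSum-tabulate (f ∘ suc))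

∣∣-cong : ∀ {n} {P Q : Fin n → Bool} → (∀ i → P i ≡ Q i) → ∣ P ∣ ≡ ∣ Q ∣
∣∣-cong P≗Q = sum-cong-≗ (cong 𝟙 ∘ P≗Q)

∣∣-mono : ∀ {n} (P Q : Fin n → Bool) → P ⊆ Q → ∣ P ∣ ≤ ∣ Q ∣
∣∣-mono P Q P⊆Q = ∑-mono (λ i → 𝟙-mono (P⊆Q i))

∣∣-split : ∀ {n} (P Q : Fin n → Bool) → ∣ P ∣ ≡ ∣ P ∩ Q ∣ + ∣ P ∩ ∁ Q ∣
∣∣-split P Q = trans (sum-cong-≗ (λ i → 𝟙-split (P i) (Q i))) (∑-distrib-+ (𝟙 ∘ (P ∩ Q)) (𝟙 ∘ (P ∩ ∁ Q)))

∣∣-∪ : ∀ {n} (P Q : Fin n → Bool) → ∣ P ∪ Q ∣ ≤ ∣ P ∣ + ∣ Q ∣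
∣∣-∪ P Q = ≤-trans (∑-mono (λ i → 𝟙-∨ (P i) (Q i))) (≤-reflexive (∑-distrib-+ (𝟙 ∘ P) (𝟙 ∘ Q)))

∣∣-pos : ∀ {n} (P : Fin n → Bool) {i : Fin n} → T (P i) → 0 < ∣ P ∣
∣∣-pos P {zero}  Pi = ≤-trans (𝟙-mono {true} (λ _ → Pi)) (m≤m+n _ _)
∣∣-pos P {suc i} Pi = ≤-trans (∣∣-pos (P ∘ suc) Pi) (m≤n+m _ _)

∣∣-∩∁< : ∀ {n} (P Q : Fin n → Bool) {i} → T (P i) → T (Q i) → ∣ P ∩ ∁ Q ∣ < ∣ P ∣
∣∣-∩∁< P Q Pi Qi = begin-strict
  ∣ P ∩ ∁ Q ∣                  <⟨ +-monoˡ-≤ ∣ P ∩ ∁ Q ∣ (∣∣-pos (P ∩ Q) (T-∧ .from (Pi , Qi))) ⟩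
  ∣ P ∩ Q ∣ + ∣ P ∩ ∁ Q ∣      ≡⟨ ∣∣-split P Q ⟨
  ∣ P ∣                        ∎
  where open ≤-Reasoning

∣∣-none : ∀ {n} (P : Fin n → Bool) → (∀ i → ¬ T (P i)) → ∣ P ∣ ≡ 0
∣∣-none {n} P none = n≤0⇒n≡0 (begin
  ∣ P ∣          ≤⟨ ∣∣-mono P (λ _ → false) none ⟩
  ∑[ i < n ] 0   ≡⟨ ∑-const n 0 ⟩
  n * 0          ≡⟨ *-zeroʳ n ⟩
  0              ∎)
  where open ≤-Reasoning

∣∣-witness : ∀ {n} (P : Fin n → Bool) → 0 < ∣ P ∣ → ∃ λ i → T (P i)
∣∣-witness {suc n} P 0<∣P∣ with P zero in P0
... | true  = zero , T-≡ .from P0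
... | false = let i , Pi = ∣∣-witness (P ∘ suc) 0<∣P∣ in suc i , Pi

∣∣≤1 : ∀ {n} (P : Fin n → Bool) → (∀ {i j} → T (P i) → T (P j) → i ≡ j) → ∣ P ∣ ≤ 1
∣∣≤1 {zero}  P _      = z≤n
∣∣≤1 {suc n} P unique with P zero in P0
... | true  = s≤s (≤-reflexive (∣∣-none (P ∘ suc) (λ i Pi → 0≢suc (unique (T-≡ .from P0) Pi))))
  where
  0≢suc : ∀ {i : Fin n} → zero ≢ suc i
  0≢suc ()
... | false = ∣∣≤1 (P ∘ suc) (λ Pi Pj → Fin.suc-injective (unique Pi Pj))

∣⁅⁆∣≤1 : ∀ {n} (i : Fin n) → ∣ ⁅ i ⁆ ∣ ≤ 1
∣⁅⁆∣≤1 i = ∣∣≤1 ⁅ i ⁆ (λ i≡j i≡k → trans (sym (toWitness i≡j)) (toWitness i≡k))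

∷-⊆ : ∀ {n b} {Q : Fin n → Bool} {P : Fin (suc n) → Bool} → (T b → T (P zero)) → Q ⊆ P ∘ suc → (b ∷ Q) ⊆ P
∷-⊆ b⇒P0 Q⊆P zero    = b⇒P0
∷-⊆ b⇒P0 Q⊆P (suc x) = Q⊆P x

∣∣-∖⁅⁆ : ∀ {n} (P : Fin n → Bool) (i : Fin n) → ∣ P ∣ ≤ suc ∣ P ∩ ∁ ⁅ i ⁆ ∣
∣∣-∖⁅⁆ P i = begin
  ∣ P ∣                              ≡⟨ ∣∣-split P ⁅ i ⁆ ⟩
  ∣ P ∩ ⁅ i ⁆ ∣ + ∣ P ∩ ∁ ⁅ i ⁆ ∣    ≤⟨ +-monoˡ-≤ ∣ P ∩ ∁ ⁅ i ⁆ ∣ (≤-trans ∣P∩⁅i⁆∣≤∣⁅i⁆∣ (∣⁅⁆∣≤1 i)) ⟩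
  suc ∣ P ∩ ∁ ⁅ i ⁆ ∣                ∎
  where
  open ≤-Reasoning
  ∣P∩⁅i⁆∣≤∣⁅i⁆∣ : ∣ P ∩ ⁅ i ⁆ ∣ ≤ ∣ ⁅ i ⁆ ∣
  ∣P∩⁅i⁆∣≤∣⁅i⁆∣ = ∣∣-mono (P ∩ ⁅ i ⁆) ⁅ i ⁆ (λ j → proj₂ ∘ T-∧ {P j} .to)

subset-of-size : ∀ {n} (P : Fin n → Bool) {k} → k ≤ ∣ P ∣ → Σ (Fin n → Bool) λ Q → Q ⊆ P × ∣ Q ∣ ≡ k
subset-of-size {n} P {zero} _ = (λ _ → false) , (λ _ ()) , ∣∣-none {n} (λ _ → false) (λ _ ())
subset-of-size {suc n} P {suc k} k<∣P∣ with P zero in P0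
... | true  = let Q , Q⊆P , ∣Q∣ = subset-of-size (P ∘ suc) (≤-pred k<∣P∣)
              in (true ∷ Q) , ∷-⊆ (λ _ → T-≡ .from P0) Q⊆P , cong suc ∣Q∣
... | false = let Q , Q⊆P , ∣Q∣ = subset-of-size (P ∘ suc) k<∣P∣
              in (false ∷ Q) , ∷-⊆ (λ ()) Q⊆P , ∣Q∣

argmax : ∀ {n} → Fin n → (f : Fin n → ℕ) → ∃ λ i → ∀ j → f j ≤ f i
argmax {suc zero} _ f = zero , λ where zero → ≤-refl
argmax {suc (suc n)} _ f with (i , max) ← argmax zero (f ∘ suc) | ≤-total (f (suc i)) (f zero)
... | inj₁ fi≤f0 = zero  , λ where zero → ≤-refl ; (suc j) → ≤-trans (max j) fi≤f0
... | inj₂ f0≤fi = suc i , λ where zero → f0≤fi  ; (suc j) → max j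

any : ∀ {n} → (Fin n → Bool) → Bool
any {zero}  P = false
any {suc n} P = P zero ∨ any (P ∘ suc)

any-intro : ∀ {n} (P : Fin n → Bool) {i} → T (P i) → T (any P)
any-intro P {zero}  Pi = T-∨ .from (inj₁ Pi)
any-intro P {suc i} Pi = T-∨ {P zero} .from (inj₂ (any-intro (P ∘ suc) Pi))

any-elim : ∀ {n} (P : Fin n → Bool) → T (any P) → ∃ λ i → T (P i)
any-elim {suc n} P anyP with P zero in P0
... | true  = zero , T-≡ .from P0
... | false = let i , Pi = any-elim (P ∘ suc) anyP in suc i , Pi

any-cong : ∀ {n} {P Q : Fin n → Bool} → (∀ i → P i ≡ Q i) → any P ≡ any Q
any-cong {zero}  P≗Q = refl
any-cong {suc n} P≗Q = cong₂ _∨_ (P≗Q zero) (any-cong (P≗Q ∘ suc))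

𝟙-any : ∀ {n} (P : Fin n → Bool) → 𝟙 (any P) ≤ ∣ P ∣
𝟙-any {zero}  P = z≤n
𝟙-any {suc n} P = ≤-trans (𝟙-∨ (P zero) _) (+-monoʳ-≤ (𝟙 (P zero)) (𝟙-any (P ∘ suc)))

-- Counting assignments

∑ₐ : ∀ {n} → ((Fin n → Bool) → ℕ) → ℕ
∑ₐ {zero}  f = f []
∑ₐ {suc n} f = ∑ₐ (λ q → f (true ∷ q)) + ∑ₐ (λ q → f (false ∷ q))

∑ₐ-cong : ∀ {n} {f g : (Fin n → Bool) → ℕ} → (∀ q → f q ≡ g q) → ∑ₐ f ≡ ∑ₐ g
∑ₐ-cong {zero}  f≗g = f≗g []
∑ₐ-cong {suc n} f≗g = cong₂ _+_ (∑ₐ-cong (f≗g ∘ (true ∷_))) (∑ₐ-cong (f≗g ∘ (false ∷_)))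

∑ₐ-mono : ∀ {n} {f g : (Fin n → Bool) → ℕ} → (∀ q → f q ≤ g q) → ∑ₐ f ≤ ∑ₐ g
∑ₐ-mono {zero}  f≤g = f≤g []
∑ₐ-mono {suc n} f≤g = +-mono-≤ (∑ₐ-mono (f≤g ∘ (true ∷_))) (∑ₐ-mono (f≤g ∘ (false ∷_)))

∑ₐ-distrib-+ : ∀ {n} (f g : (Fin n → Bool) → ℕ) → ∑ₐ (λ q → f q + g q) ≡ ∑ₐ f + ∑ₐ g
∑ₐ-distrib-+ {zero}  f g = refl
∑ₐ-distrib-+ {suc n} f g = trans
  (cong₂ _+_ (∑ₐ-distrib-+ (f ∘ (true ∷_)) (g ∘ (true ∷_))) (∑ₐ-distrib-+ (f ∘ (false ∷_)) (g ∘ (false ∷_))))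
  (+-interchange (∑ₐ (f ∘ (true ∷_))) (∑ₐ (g ∘ (true ∷_))) (∑ₐ (f ∘ (false ∷_))) (∑ₐ (g ∘ (false ∷_))))

∑ₐ-∑-comm : ∀ {n N} (f : Fin N → (Fin n → Bool) → ℕ) → ∑ₐ (λ q → ∑[ j < N ] f j q) ≡ ∑[ j < N ] ∑ₐ (f j)
∑ₐ-∑-comm {zero}  f = refl
∑ₐ-∑-comm {suc n} f = trans
  (cong₂ _+_ (∑ₐ-∑-comm (λ j q → f j (true ∷ q))) (∑ₐ-∑-comm (λ j q → f j (false ∷ q))))
  (sym (∑-distrib-+ (λ j → ∑ₐ (λ q → f j (true ∷ q))) (λ j → ∑ₐ (λ q → f j (false ∷ q)))))

-- #sat Φ / 2 ^ n is the probability of Φ for a uniformly random assignment.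
#sat : ∀ {n} → ((Fin n → Bool) → Bool) → ℕ
#sat Φ = ∑ₐ (𝟙 ∘ Φ)

#sat-cong : ∀ {n} {Φ Ψ : (Fin n → Bool) → Bool} → (∀ q → Φ q ≡ Ψ q) → #sat Φ ≡ #sat Ψ
#sat-cong Φ≗Ψ = ∑ₐ-cong (cong 𝟙 ∘ Φ≗Ψ)

#sat-mono : ∀ {n} (Φ Ψ : (Fin n → Bool) → Bool) → Φ ⊆ Ψ → #sat Φ ≤ #sat Ψ
#sat-mono Φ Ψ Φ⊆Ψ = ∑ₐ-mono (λ q → 𝟙-mono (Φ⊆Ψ q))

#sat-split : ∀ {n} (Φ Ψ : (Fin n → Bool) → Bool) → #sat Φ ≡ #sat (Φ ∩ Ψ) + #sat (Φ ∩ ∁ Ψ)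
#sat-split Φ Ψ = trans (∑ₐ-cong (λ q → 𝟙-split (Φ q) (Ψ q))) (∑ₐ-distrib-+ (𝟙 ∘ (Φ ∩ Ψ)) (𝟙 ∘ (Φ ∩ ∁ Ψ)))

#sat-∪ : ∀ {n} (Φ Ψ : (Fin n → Bool) → Bool) → #sat (Φ ∪ Ψ) ≤ #sat Φ + #sat Ψ
#sat-∪ Φ Ψ = ≤-trans (∑ₐ-mono (λ q → 𝟙-∨ (Φ q) (Ψ q))) (≤-reflexive (∑ₐ-distrib-+ (𝟙 ∘ Φ) (𝟙 ∘ Ψ)))

#sat-none : ∀ {n} (Φ : (Fin n → Bool) → Bool) → (∀ q → ¬ T (Φ q)) → #sat Φ ≡ 0
#sat-none {n} Φ none = n≤0⇒n≡0 (≤-trans (∑ₐ-mono (λ q → 𝟙-mono {b = false} (none q))) (≤-reflexive (∑ₐ-zero n)))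
  where
  ∑ₐ-zero : ∀ n → ∑ₐ {n} (λ _ → 0) ≡ 0
  ∑ₐ-zero zero    = refl
  ∑ₐ-zero (suc n) = cong₂ _+_ (∑ₐ-zero n) (∑ₐ-zero n)

#sat-all : ∀ n → #sat {n} (λ _ → true) ≡ 2 ^ n
#sat-all zero    = refl
#sat-all (suc n) = cong₂ _+_ (#sat-all n) (trans (#sat-all n) (sym (+-identityʳ (2 ^ n))))

#sat-witness : ∀ {n} (Φ : (Fin n → Bool) → Bool) → 0 < #sat Φ → ∃ λ q → T (Φ q)
#sat-witness {zero}  Φ 0<#Φ with Φ [] in Φ[]
... | true = [] , T-≡ .from Φ[]
#sat-witness {suc n} Φ 0<#Φ with 0 <? #sat (Φ ∘ (true ∷_))
... | yes 0<#Φt = let q , Φq = #sat-witness _ 0<#Φt in true ∷ q , Φq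
... | no  0≮#Φt = let q , Φq = #sat-witness _ (≤-trans 0<#Φ (+-monoˡ-≤ _ (≮⇒≥ 0≮#Φt))) in false ∷ q , Φq

#sat-union-bound : ∀ {n N} (Φ : (Fin n → Bool) → Bool) (E : Fin N → (Fin n → Bool) → Bool) →
  #sat Φ ≤ #sat (λ q → Φ q ∧ not (any λ j → E j q)) + ∑[ j < N ] #sat (Φ ∩ E j)
#sat-union-bound {n} {N} Φ E = begin
  ∑ₐ (𝟙 ∘ Φ)                                        ≤⟨ ∑ₐ-mono pointwise ⟩
  ∑ₐ (λ q → 𝟙 (rest q) + ∑[ j < N ] 𝟙 (hit j q))    ≡⟨ ∑ₐ-distrib-+ (𝟙 ∘ rest) (λ q → ∑[ j < N ] 𝟙 (hit j q)) ⟩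
  #sat rest + ∑ₐ (λ q → ∑[ j < N ] 𝟙 (hit j q))     ≡⟨ cong (#sat rest +_) (∑ₐ-∑-comm (λ j → 𝟙 ∘ hit j)) ⟩
  #sat rest + ∑[ j < N ] #sat (hit j)                ∎
  where
  open ≤-Reasoning
  hits : (Fin n → Bool) → Bool
  hits q = any (λ j → E j q)
  rest : (Fin n → Bool) → Bool
  rest q = Φ q ∧ not (hits q)
  hit : Fin N → (Fin n → Bool) → Bool
  hit j = Φ ∩ E j
  𝟙-∧-any : ∀ a (e : Fin N → Bool) → 𝟙 (a ∧ any e) ≤ ∑[ j < N ] 𝟙 (a ∧ e j)
  𝟙-∧-any false e = z≤n
  𝟙-∧-any true  e = 𝟙-any e
  pointwise : ∀ q → 𝟙 (Φ q) ≤ 𝟙 (rest q) + ∑[ j < N ] 𝟙 (hit j q)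
  pointwise q = begin
    𝟙 (Φ q)                                         ≡⟨ 𝟙-split (Φ q) (hits q) ⟩
    𝟙 (Φ q ∧ hits q) + 𝟙 (rest q)                   ≤⟨ +-monoˡ-≤ (𝟙 (rest q)) (𝟙-∧-any (Φ q) (λ j → E j q)) ⟩
    ∑[ j < N ] 𝟙 (hit j q) + 𝟙 (rest q)             ≡⟨ +-comm (∑[ j < N ] 𝟙 (hit j q)) (𝟙 (rest q)) ⟩
    𝟙 (rest q) + ∑[ j < N ] 𝟙 (hit j q)             ∎

DeterminedBy : ∀ {n} → (Fin n → Bool) → ((Fin n → Bool) → Bool) → Set
DeterminedBy C Φ = ∀ q q′ → (∀ x → T (C x) → q x ≡ q′ x) → Φ q ≡ Φ q′

DeterminedBy-tail : ∀ {n C} {Φ : (Fin (suc n) → Bool) → Bool} → DeterminedBy C Φ →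
  ∀ b → DeterminedBy (C ∘ suc) (λ q → Φ (b ∷ q))
DeterminedBy-tail det b q q′ agree = det (b ∷ q) (b ∷ q′) λ where
  zero    _  → refl
  (suc x) Cx → agree x Cx

DeterminedBy-head : ∀ {n C} {Φ : (Fin (suc n) → Bool) → Bool} → DeterminedBy C Φ → ¬ T (C zero) →
  ∀ q → Φ (true ∷ q) ≡ Φ (false ∷ q)
DeterminedBy-head det 0∉C q = det (true ∷ q) (false ∷ q) λ where
  zero    0∈C → ⊥-elim (0∉C 0∈C)
  (suc x) _   → refl

#sat-independent : ∀ {n} (C : Fin n → Bool) {Φ Ψ : (Fin n → Bool) → Bool} →
  DeterminedBy C Φ → DeterminedBy (∁ C) Ψ → #sat (Φ ∩ Ψ) * 2 ^ n ≡ #sat Φ * #sat Ψ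
#sat-independent {zero}  C {Φ} {Ψ} _ _ = trans (*-identityʳ (𝟙 (Φ [] ∧ Ψ []))) (𝟙-∧ (Φ []) (Ψ []))
#sat-independent {suc n} C {Φ} {Ψ} detΦ detΨ = begin
  (#sat (Φ₁ ∩ Ψ₁) + #sat (Φ₀ ∩ Ψ₀)) * (2 * 2 ^ n)         ≡⟨ regroup (#sat (Φ₁ ∩ Ψ₁)) (#sat (Φ₀ ∩ Ψ₀)) (2 ^ n) ⟩
  (#sat (Φ₁ ∩ Ψ₁) * 2 ^ n + #sat (Φ₀ ∩ Ψ₀) * 2 ^ n) * 2   ≡⟨ cong (_* 2) (cong₂ _+_ (IH true) (IH false)) ⟩
  (#sat Φ₁ * #sat Ψ₁ + #sat Φ₀ * #sat Ψ₀) * 2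
    ≡⟨ balanced (#sat Φ₁) (#sat Φ₀) (#sat Ψ₁) (#sat Ψ₀) head-ignored ⟩
  (#sat Φ₁ + #sat Φ₀) * (#sat Ψ₁ + #sat Ψ₀)               ∎
  where
  open ≡-Reasoning
  Φ₁ Φ₀ Ψ₁ Ψ₀ : (Fin n → Bool) → Bool
  Φ₁ q = Φ (true ∷ q)
  Φ₀ q = Φ (false ∷ q)
  Ψ₁ q = Ψ (true ∷ q)
  Ψ₀ q = Ψ (false ∷ q)
  IH : ∀ b → #sat (λ q → Φ (b ∷ q) ∧ Ψ (b ∷ q)) * 2 ^ n ≡ #sat (λ q → Φ (b ∷ q)) * #sat (λ q → Ψ (b ∷ q))
  IH b = #sat-independent (C ∘ suc) (DeterminedBy-tail detΦ b) (DeterminedBy-tail detΨ b)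
  head-ignored : #sat Φ₁ ≡ #sat Φ₀ ⊎ #sat Ψ₁ ≡ #sat Ψ₀
  head-ignored with C zero in C0
  ... | true  = inj₂ (#sat-cong (DeterminedBy-head detΨ (subst (T ∘ not) C0)))
  ... | false = inj₁ (#sat-cong (DeterminedBy-head detΦ (subst T C0)))
  regroup : ∀ a b c → (a + b) * (2 * c) ≡ (a * c + b * c) * 2
  regroup = solve-∀
  balanced : ∀ a b c d → a ≡ b ⊎ c ≡ d → (a * c + b * d) * 2 ≡ (a + b) * (c + d)
  balanced a .a c d (inj₁ refl) = left a c d
    where
    left : ∀ a c d → (a * c + a * d) * 2 ≡ (a + a) * (c + d)
    left = solve-∀
  balanced a b c .c (inj₂ refl) = right a b c
    where
    right : ∀ a b c → (a * c + b * c) * 2 ≡ (a + b) * (c + c)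
    right = solve-∀

-- The Lovász Local Lemma

overlaps : ∀ {n} → (Fin n → Bool) → (Fin n → Bool) → Bool
overlaps P Q = any (P ∩ Q)

overlaps-intro : ∀ {n} {P Q : Fin n → Bool} {x} → T (P x) → T (Q x) → T (overlaps P Q)
overlaps-intro {P = P} {Q} Px Qx = any-intro (P ∩ Q) (T-∧ .from (Px , Qx))

overlap-count : ∀ {n N} (C : Fin N → Fin n → Bool) (i : Fin N) c → (∀ x → ∣ (λ j → C j x) ∣ ≤ c) →
  ∣ (λ j → overlaps (C i) (C j)) ∣ ≤ ∣ C i ∣ * c
overlap-count {n} {N} C i c degree≤c = begin
  ∑[ j < N ] 𝟙 (any (C i ∩ C j))                  ≤⟨ ∑-mono (λ j → 𝟙-any (C i ∩ C j)) ⟩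
  ∑[ j < N ] ∑[ x < n ] 𝟙 (C i x ∧ C j x)         ≡⟨ ∑-comm (λ j x → 𝟙 (C i x ∧ C j x)) ⟩
  ∑[ x < n ] ∑[ j < N ] 𝟙 (C i x ∧ C j x)         ≤⟨ ∑-mono row ⟩
  ∑[ x < n ] (𝟙 (C i x) * c)                      ≡⟨ *-distribʳ-sum c (𝟙 ∘ C i) ⟨
  ∣ C i ∣ * c                                     ∎
  where
  open ≤-Reasoning
  row : ∀ x → ∑[ j < N ] 𝟙 (C i x ∧ C j x) ≤ 𝟙 (C i x) * c
  row x with C i x
  ... | true  = ≤-trans (degree≤c x) (≤-reflexive (sym (+-identityʳ c)))
  ... | false = ≤-reflexive (trans (∑-const N 0) (*-zeroʳ N))

bootstrap : ∀ D X Y Z .{{_ : NonZero D}} → X ≤ Y + Z → 2 * D * Z ≤ D * X → X ≤ 2 * Y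
bootstrap D X Y Z X≤Y+Z small = *-cancelˡ-≤ D (+-cancelʳ-≤ (D * X) (D * X) (D * (2 * Y)) (begin
  D * X + D * X          ≡⟨ double D X ⟩
  2 * D * X              ≤⟨ *-monoʳ-≤ (2 * D) X≤Y+Z ⟩
  2 * D * (Y + Z)        ≡⟨ *-distribˡ-+ (2 * D) Y Z ⟩
  2 * D * Y + 2 * D * Z  ≤⟨ +-monoʳ-≤ (2 * D * Y) small ⟩
  2 * D * Y + D * X      ≡⟨ cong (_+ D * X) (reassoc D Y) ⟩
  D * (2 * Y) + D * X    ∎))
  where
  open ≤-Reasoning
  double : ∀ d x → d * x + d * x ≡ 2 * d * x
  double = solve-∀
  reassoc : ∀ d y → 2 * d * y ≡ d * (2 * y)
  reassoc = solve-∀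

positive-remainder : ∀ D a b .{{_ : NonZero D}} → 2 * D * a ≤ a + b → 0 < a + b → 0 < b
positive-remainder D a (suc b) _     _   = s≤s z≤n
positive-remainder D a zero    2Da≤a 0<a = ⊥-elim (<-irrefl refl (≤-trans 0<a (begin
  a + 0          ≡⟨ +-identityʳ a ⟩
  a              ≤⟨ +-cancelˡ-≤ a a 0 (begin
                      a + a        ≡⟨ cong (a +_) (sym (+-identityʳ a)) ⟩
                      2 * a        ≤⟨ *-monoˡ-≤ a (*-monoʳ-≤ 2 (>-nonZero⁻¹ D)) ⟩
                      2 * D * a    ≤⟨ 2Da≤a ⟩
                      a + 0        ∎) ⟩
  0              ∎)))
  where open ≤-Reasoning

-- Symmetric form with constant 4: P(A i) ≤ 1/(4D), where D also counts A i itself.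
module LovászLocalLemma {n N : ℕ}
  (A : Fin N → (Fin n → Bool) → Bool) (scope : Fin N → Fin n → Bool)
  (A-determined : ∀ i → DeterminedBy (scope i) (A i))
  (D : ℕ) .{{_ : NonZero D}}
  (sparse : ∀ i → ∣ (λ j → overlaps (scope i) (scope j)) ∣ ≤ D)
  (rare : ∀ i → 4 * D * #sat (A i) ≤ 2 ^ n)
  where

  avoiding : (Fin N → Bool) → (Fin n → Bool) → Bool
  avoiding I q = not (any λ j → I j ∧ A j q)

  avoiding-intro : ∀ {I q} → (∀ j → T (I j) → ¬ T (A j q)) → T (avoiding I q)
  avoiding-intro {I} {q} avoids = ¬T⇒T-not λ hit →
    let j , Ij∧Aj = any-elim (λ j → I j ∧ A j q) hit ; Ij , Aj = T-∧ .to Ij∧Aj in avoids j Ij Aj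

  avoiding-elim : ∀ {I q j} → T (avoiding I q) → T (I j) → ¬ T (A j q)
  avoiding-elim {I} {q} av Ij Aj = T-not⇒¬T av (any-intro (λ j → I j ∧ A j q) (T-∧ .from (Ij , Aj)))

  meets : Fin N → Fin N → Bool
  meets i j = overlaps (scope i) (scope j)

  far : (Fin N → Bool) → Fin N → Fin N → Bool
  far I i = I ∩ ∁ (meets i)

  avoiding-far-determined : ∀ I i → DeterminedBy (∁ (scope i)) (avoiding (far I i))
  avoiding-far-determined I i q q′ agree = cong not (any-cong same)
    where
    same : ∀ j → far I i j ∧ A j q ≡ far I i j ∧ A j q′
    same j with far I i j in j-far
    ... | false = refl
    ... | true  = A-determined j q q′ λ x x∈j → agree x (¬T⇒T-not λ x∈i →
      T-not⇒¬T (proj₂ (T-∧ {I j} .to (T-≡ .from j-far))) (overlaps-intro {P = scope i} {scope j} x∈i x∈j))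

  avoiding-∩∁≤2*avoiding : ∀ I R →
    (∀ j → T (I j ∧ R j) → 2 * D * #sat (avoiding (I ∩ ∁ R) ∩ A j) ≤ #sat (avoiding (I ∩ ∁ R))) →
    ∣ I ∩ R ∣ ≤ D → #sat (avoiding (I ∩ ∁ R)) ≤ 2 * #sat (avoiding I)
  avoiding-∩∁≤2*avoiding I R near-bound ∣near∣≤D = bootstrap D X Y Z (≤-trans union (+-monoˡ-≤ Z rest≤Y)) error-small
    where
    near : Fin N → Bool
    near = I ∩ R
    E : Fin N → (Fin n → Bool) → Bool
    E j q = near j ∧ A j q
    X Y Z : ℕ
    X = #sat (avoiding (I ∩ ∁ R))
    Y = #sat (avoiding I)
    Z = ∑[ j < N ] #sat (avoiding (I ∩ ∁ R) ∩ E j)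
    rest : (Fin n → Bool) → Bool
    rest q = avoiding (I ∩ ∁ R) q ∧ not (any λ j → E j q)
    union : X ≤ #sat rest + Z
    union = #sat-union-bound (avoiding (I ∩ ∁ R)) E
    rest⊆avoiding : ∀ q → T (rest q) → T (avoiding I q)
    rest⊆avoiding q rest-q = avoiding-intro avoids
      where
      avoids : ∀ j → T (I j) → ¬ T (A j q)
      avoids j Ij Aj with R j in Rj
      ... | true  = T-not⇒¬T (proj₂ (T-∧ .to rest-q))
                      (any-intro (λ j → E j q) (T-∧ .from (T-∧ .from (Ij , T-≡ .from Rj) , Aj)))
      ... | false = avoiding-elim (proj₁ (T-∧ .to rest-q)) (T-∧ .from (Ij , T-≡ .from (cong not Rj))) Aj
    rest≤Y : #sat rest ≤ Y
    rest≤Y = #sat-mono rest (avoiding I) rest⊆avoiding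
    term : ∀ j → 2 * D * #sat (avoiding (I ∩ ∁ R) ∩ E j) ≤ 𝟙 (near j) * X
    term j with near j in near-j
    ... | true  = ≤-trans (near-bound j (T-≡ .from near-j)) (≤-reflexive (sym (+-identityʳ X)))
    ... | false = ≤-reflexive (trans (cong (2 * D *_) (#sat-none _ λ q hit → proj₂ (T-∧ {avoiding (I ∩ ∁ R) q} .to hit)))
                                     (*-zeroʳ (2 * D)))
    error-small : 2 * D * Z ≤ D * X
    error-small = begin
      2 * D * Z
        ≡⟨ *-distribˡ-sum (2 * D) (λ j → #sat (avoiding (I ∩ ∁ R) ∩ E j)) ⟩
      ∑[ j < N ] (2 * D * #sat (avoiding (I ∩ ∁ R) ∩ E j))    ≤⟨ ∑-mono term ⟩
      ∑[ j < N ] (𝟙 (near j) * X)                             ≡⟨ *-distribʳ-sum X (𝟙 ∘ near) ⟨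
      ∣ near ∣ * X                                            ≤⟨ *-monoˡ-≤ X ∣near∣≤D ⟩
      D * X                                                   ∎
      where open ≤-Reasoning

  conditional-bound : ∀ k I → ∣ I ∣ < k → ∀ i → 2 * D * #sat (avoiding I ∩ A i) ≤ #sat (avoiding I)
  conditional-bound (suc k) I (s≤s ∣I∣≤k) i = *-cancelʳ-≤ (2 * D * a) Y (2 ^ suc n) {{m^n≢0 2 (suc n)}} (begin
    2 * D * a * (2 * 2 ^ n)        ≤⟨ *-monoˡ-≤ (2 * 2 ^ n) (*-monoʳ-≤ (2 * D) a≤a-far) ⟩
    2 * D * a-far * (2 * 2 ^ n)    ≡⟨ regroup D a-far (2 ^ n) ⟩
    4 * D * (a-far * 2 ^ n)        ≡⟨ cong (4 * D *_) independent ⟩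
    4 * D * (#sat (A i) * X)       ≡⟨ *-assoc (4 * D) (#sat (A i)) X ⟨
    4 * D * #sat (A i) * X         ≤⟨ *-monoˡ-≤ X (rare i) ⟩
    2 ^ n * X                      ≤⟨ *-monoʳ-≤ (2 ^ n) X≤2Y ⟩
    2 ^ n * (2 * Y)                ≡⟨ swap (2 ^ n) Y ⟩
    Y * (2 * 2 ^ n)                ∎)
    where
    open ≤-Reasoning
    X Y a a-far : ℕ
    X = #sat (avoiding (far I i))
    Y = #sat (avoiding I)
    a = #sat (avoiding I ∩ A i)
    a-far = #sat (avoiding (far I i) ∩ A i)
    a≤a-far : a ≤ a-far
    a≤a-far = #sat-mono (avoiding I ∩ A i) (avoiding (far I i) ∩ A i) λ q h → let av , Ai = T-∧ .to h in
      T-∧ .from (avoiding-intro (λ j j-far → avoiding-elim av (proj₁ (T-∧ .to j-far))) , Ai)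
    independent : a-far * 2 ^ n ≡ #sat (A i) * X
    independent = trans (cong (_* 2 ^ n) (#sat-cong λ q → ∧-comm (avoiding (far I i) q) (A i q)))
                        (#sat-independent (scope i) (A-determined i) (avoiding-far-determined I i))
    X≤2Y : X ≤ 2 * Y
    X≤2Y = avoiding-∩∁≤2*avoiding I (meets i)
      (λ j j-near → let Ij , j-meets = T-∧ .to j-near in
                    conditional-bound k (far I i) (≤-trans (∣∣-∩∁< I (meets i) Ij j-meets) ∣I∣≤k) j)
      (≤-trans (∣∣-mono (I ∩ meets i) (meets i) λ j j-near → proj₂ (T-∧ {I j} .to j-near)) (sparse i))
    regroup : ∀ d x y → 2 * d * x * (2 * y) ≡ 4 * d * (x * y)
    regroup = solve-∀
    swap : ∀ y z → y * (2 * z) ≡ z * (2 * y)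
    swap = solve-∀

  avoiding-nonempty : ∀ k I → ∣ I ∣ < k → 0 < #sat (avoiding I)
  avoiding-nonempty (suc k) I (s≤s ∣I∣≤k) with 0 <? ∣ I ∣
  ... | no I-empty = begin-strict
    0                         <⟨ m^n>0 2 n ⟩
    2 ^ n                     ≡⟨ #sat-all n ⟨
    #sat {n} (λ _ → true)     ≤⟨ #sat-mono (λ _ → true) (avoiding I) avoids-all ⟩
    #sat (avoiding I)         ∎
    where
    open ≤-Reasoning
    avoids-all : ∀ q → T true → T (avoiding I q)
    avoids-all q _ = avoiding-intro λ j Ij _ → I-empty (∣∣-pos I Ij)
  ... | yes ∣I∣>0 = ≤-trans remainder>0 (#sat-mono (avoiding I′ ∩ ∁ (A i)) (avoiding I) remainder⊆avoiding)
    where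
    i : Fin N
    i = proj₁ (∣∣-witness I ∣I∣>0)
    I′ : Fin N → Bool
    I′ = I ∩ ∁ ⁅ i ⁆
    ∣I′∣<k : ∣ I′ ∣ < k
    ∣I′∣<k = ≤-trans (∣∣-∩∁< I ⁅ i ⁆ (proj₂ (∣∣-witness I ∣I∣>0)) (fromWitness refl)) ∣I∣≤k
    split : #sat (avoiding I′) ≡ #sat (avoiding I′ ∩ A i) + #sat (avoiding I′ ∩ ∁ (A i))
    split = #sat-split (avoiding I′) (A i)
    remainder>0 : 0 < #sat (avoiding I′ ∩ ∁ (A i))
    remainder>0 = positive-remainder D _ _
      (subst (2 * D * #sat (avoiding I′ ∩ A i) ≤_) split (conditional-bound (suc ∣ I′ ∣) I′ ≤-refl i))
      (subst (0 <_) split (avoiding-nonempty k I′ ∣I′∣<k))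
    remainder⊆avoiding : ∀ q → T (avoiding I′ q ∧ not (A i q)) → T (avoiding I q)
    remainder⊆avoiding q h = avoiding-intro avoids
      where
      avoids : ∀ j → T (I j) → ¬ T (A j q)
      avoids j Ij with ⁅ i ⁆ j in i≟j
      ... | true  = subst (λ j → ¬ T (A j q)) (toWitness (T-≡ .from i≟j)) (T-not⇒¬T (proj₂ (T-∧ .to h)))
      ... | false = avoiding-elim (proj₁ (T-∧ .to h)) (T-∧ .from (Ij , T-≡ .from (cong not i≟j)))

  lovász-local-lemma : ∃ λ q → ∀ i → ¬ T (A i q)
  lovász-local-lemma =
    let q , avoids-all = #sat-witness (avoiding everything) (avoiding-nonempty _ everything ≤-refl)
    in q , λ i → avoiding-elim avoids-all _
    where
    everything : Fin N → Bool
    everything _ = true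

-- Binomial tails

binomial-marginal : ∀ {n} (F : Fin n → Bool) (c : Bool) (h : ℕ → Bool) →
  #sat (λ q → h ∣ F ∩ (λ w → q w == c) ∣) * 2 ^ ∣ F ∣ ≡ 2 ^ n * #sat {∣ F ∣} (λ r → h ∣ r ∣)
binomial-marginal {zero}  F c h = *-comm (𝟙 (h 0)) 1
binomial-marginal {suc n} F c h with F zero
... | false = begin
  (x + x) * 2 ^ K                 ≡⟨ *-distribʳ-+ (2 ^ K) x x ⟩
  x * 2 ^ K + x * 2 ^ K           ≡⟨ cong₂ _+_ (binomial-marginal F′ c h) (binomial-marginal F′ c h) ⟩
  2 ^ n * W h + 2 ^ n * W h       ≡⟨ double (2 ^ n) (W h) ⟩
  2 * 2 ^ n * W h                 ∎
  where
  open ≡-Reasoning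
  F′ : Fin n → Bool
  F′ = F ∘ suc
  K x : ℕ
  K = ∣ F′ ∣
  x = #sat (λ q → h ∣ F′ ∩ (λ w → q w == c) ∣)
  W : (ℕ → Bool) → ℕ
  W h = #sat {K} (λ r → h ∣ r ∣)
  double : ∀ a b → a * b + a * b ≡ 2 * a * b
  double = solve-∀
... | true = begin
  (x true + x false) * (2 * 2 ^ K)                   ≡⟨ distrib (x true) (x false) (2 ^ K) ⟩
  2 * (x true * 2 ^ K + x false * 2 ^ K)             ≡⟨ cong (2 *_) (cong₂ _+_ (IH true) (IH false)) ⟩
  2 * (2 ^ n * W (shifted true) + 2 ^ n * W (shifted false))
                                                     ≡⟨ factor (2 ^ n) (W (shifted true)) (W (shifted false)) ⟩
  2 * 2 ^ n * (W (shifted true) + W (shifted false)) ≡⟨ cong (2 * 2 ^ n *_) (colour-of-head c) ⟩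
  2 * 2 ^ n * (W (h ∘ suc) + W h)                    ∎
  where
  open ≡-Reasoning
  F′ : Fin n → Bool
  F′ = F ∘ suc
  K : ℕ
  K = ∣ F′ ∣
  shifted : Bool → ℕ → Bool
  shifted b k = h (𝟙 (b == c) + k)
  x : Bool → ℕ
  x b = #sat (λ q → shifted b ∣ F′ ∩ (λ w → q w == c) ∣)
  W : (ℕ → Bool) → ℕ
  W h = #sat {K} (λ r → h ∣ r ∣)
  IH : ∀ b → x b * 2 ^ K ≡ 2 ^ n * W (shifted b)
  IH b = binomial-marginal F′ c (shifted b)
  colour-of-head : ∀ c → W (λ k → h (𝟙 (true == c) + k)) + W (λ k → h (𝟙 (false == c) + k)) ≡ W (h ∘ suc) + W h
  colour-of-head true  = refl
  colour-of-head false = +-comm (W h) (W (h ∘ suc))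
  distrib : ∀ a b N → (a + b) * (2 * N) ≡ 2 * (a * N + b * N)
  distrib = solve-∀
  factor : ∀ M w₁ w₀ → 2 * (M * w₁ + M * w₀) ≡ 2 * M * (w₁ + w₀)
  factor = solve-∀

binomial-tail : ∀ N t → #sat {N} (λ r → ∣ r ∣ <ᵇ t) * 3 ^ N ≤ 3 ^ t * 4 ^ N
binomial-tail zero    t       = *-monoˡ-≤ 1 (≤-trans (𝟙≤1 (0 <ᵇ t)) (m^n>0 3 t))
binomial-tail (suc N) zero    = ≤-trans (≤-reflexive (cong (_* 3 ^ suc N) nothing-below-0)) z≤n
  where
  nothing-below-0 : #sat {suc N} (λ r → ∣ r ∣ <ᵇ 0) ≡ 0
  nothing-below-0 = #sat-none {suc N} (λ r → ∣ r ∣ <ᵇ 0) (λ _ ())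
binomial-tail (suc N) (suc t) = begin
  (below t + below (suc t)) * (3 * 3 ^ N)               ≡⟨ distrib (below t) (below (suc t)) (3 ^ N) ⟩
  3 * (below t * 3 ^ N) + 3 * (below (suc t) * 3 ^ N)   ≤⟨ +-mono-≤ (*-monoʳ-≤ 3 (binomial-tail N t))
                                                                     (*-monoʳ-≤ 3 (binomial-tail N (suc t))) ⟩
  3 * (3 ^ t * 4 ^ N) + 3 * (3 * 3 ^ t * 4 ^ N)         ≡⟨ collect (3 ^ t) (4 ^ N) ⟩
  3 * 3 ^ t * (4 * 4 ^ N)                               ∎
  where
  open ≤-Reasoning
  below : ℕ → ℕ
  below t = #sat {N} (λ r → ∣ r ∣ <ᵇ t)
  distrib : ∀ a b c → (a + b) * (3 * c) ≡ 3 * (a * c) + 3 * (b * c)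
  distrib = solve-∀
  collect : ∀ x y → 3 * (x * y) + 3 * (3 * x * y) ≡ 3 * x * (4 * y)
  collect = solve-∀

random-colour-tail : ∀ {n} (F : Fin n → Bool) c t →
  #sat (λ q → ∣ F ∩ (λ w → q w == c) ∣ <ᵇ t) * 3 ^ ∣ F ∣ ≤ 2 ^ n * 3 ^ t * 2 ^ ∣ F ∣
random-colour-tail {n} F c t = *-cancelʳ-≤ (B * 3 ^ K) (2 ^ n * 3 ^ t * 2 ^ K) (2 ^ K) {{m^n≢0 2 K}} (begin
  B * 3 ^ K * 2 ^ K                       ≡⟨ swap B (3 ^ K) (2 ^ K) ⟩
  B * 2 ^ K * 3 ^ K                       ≡⟨ cong (_* 3 ^ K) (binomial-marginal F c (_<ᵇ t)) ⟩
  2 ^ n * W * 3 ^ K                       ≡⟨ *-assoc (2 ^ n) W (3 ^ K) ⟩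
  2 ^ n * (W * 3 ^ K)                     ≤⟨ *-monoʳ-≤ (2 ^ n) (binomial-tail K t) ⟩
  2 ^ n * (3 ^ t * 4 ^ K)                 ≡⟨ cong (λ x → 2 ^ n * (3 ^ t * x)) (^-distribʳ-* 2 2 K) ⟩
  2 ^ n * (3 ^ t * (2 ^ K * 2 ^ K))       ≡⟨ regroup (2 ^ n) (3 ^ t) (2 ^ K) ⟩
  2 ^ n * 3 ^ t * 2 ^ K * 2 ^ K           ∎)
  where
  open ≤-Reasoning
  K B W : ℕ
  K = ∣ F ∣
  B = #sat (λ q → ∣ F ∩ (λ w → q w == c) ∣ <ᵇ t)
  W = #sat {K} (λ r → ∣ r ∣ <ᵇ t)
  swap : ∀ b x y → b * x * y ≡ b * y * x
  swap = solve-∀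
  regroup : ∀ a b x → a * (b * (x * x)) ≡ a * b * x * x
  regroup = solve-∀

-- The exponential series

factorial-upper : ∀ j r M → j + r ≤ M → (j + r) ! ≤ j ! * M ^ r
factorial-upper j zero    M _   rewrite +-identityʳ j = ≤-reflexive (sym (*-identityʳ (j !)))
factorial-upper j (suc r) M j+r<M rewrite +-suc j r = begin
  suc (j + r) * (j + r) !   ≤⟨ *-mono-≤ j+r<M (factorial-upper j r M (<⇒≤ j+r<M)) ⟩
  M * (j ! * M ^ r)         ≡⟨ x*[y*z]≡y*[x*z] M (j !) (M ^ r) ⟩
  j ! * (M * M ^ r)         ∎
  where
  open ≤-Reasoning
  x*[y*z]≡y*[x*z] : ∀ x y z → x * (y * z) ≡ y * (x * z)
  x*[y*z]≡y*[x*z] = solve-∀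

factorial-lower : ∀ m r → m ^ r * m ! ≤ (m + r) !
factorial-lower m zero    rewrite +-identityʳ m = ≤-reflexive (+-identityʳ (m !))
factorial-lower m (suc r) rewrite +-suc m r = begin
  m * m ^ r * m !           ≡⟨ *-assoc m (m ^ r) (m !) ⟩
  m * (m ^ r * m !)         ≤⟨ *-mono-≤ (m≤n⇒m≤1+n (m≤m+n m r)) (factorial-lower m r) ⟩
  suc (m + r) * (m + r) !   ∎
  where open ≤-Reasoning

exponential-term-max : ∀ m j → m ^ j * m ! ≤ m ^ m * j !
exponential-term-max m j with ≤-total j m
... | inj₁ j≤m with r , refl ← m≤n⇒∃[o]m+o≡n j≤m = begin
  (j + r) ^ j * (j + r) !               ≤⟨ *-monoʳ-≤ ((j + r) ^ j) (factorial-upper j r (j + r) ≤-refl) ⟩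
  (j + r) ^ j * (j ! * (j + r) ^ r)     ≡⟨ x*[y*z]≡[x*z]*y ((j + r) ^ j) (j !) ((j + r) ^ r) ⟩
  (j + r) ^ j * (j + r) ^ r * j !       ≡⟨ cong (_* j !) (^-distribˡ-+-* (j + r) j r) ⟨
  (j + r) ^ (j + r) * j !               ∎
  where
  open ≤-Reasoning
  x*[y*z]≡[x*z]*y : ∀ x y z → x * (y * z) ≡ x * z * y
  x*[y*z]≡[x*z]*y = solve-∀
... | inj₂ m≤j with r , refl ← m≤n⇒∃[o]m+o≡n m≤j = begin
  m ^ (m + r) * m !                     ≡⟨ cong (_* m !) (^-distribˡ-+-* m m r) ⟩
  m ^ m * m ^ r * m !                   ≡⟨ *-assoc (m ^ m) (m ^ r) (m !) ⟩
  m ^ m * (m ^ r * m !)                 ≤⟨ *-monoʳ-≤ (m ^ m) (factorial-lower m r) ⟩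
  m ^ m * (m + r) !                     ∎
  where open ≤-Reasoning

central-factorial : ∀ m → (m + m) ! ≤ 4 ^ m * (m ! * m !)
central-factorial zero    = ≤-refl
central-factorial (suc m) = begin
  (suc m + suc m) !                                  ≡⟨ cong _! (cong suc (+-suc m m)) ⟩
  (2 + (m + m)) * ((1 + (m + m)) * (m + m) !)        ≡⟨ *-assoc (2 + (m + m)) (1 + (m + m)) ((m + m) !) ⟨
  (2 + (m + m)) * (1 + (m + m)) * (m + m) !          ≤⟨ *-mono-≤ growth (central-factorial m) ⟩
  4 * (suc m * suc m) * (4 ^ m * (m ! * m !))        ≡⟨ regroup (suc m) (4 ^ m) (m !) ⟩
  4 * 4 ^ m * (suc m * m ! * (suc m * m !))          ∎
  where
  open ≤-Reasoning
  growth : (2 + (m + m)) * (1 + (m + m)) ≤ 4 * (suc m * suc m)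
  growth = begin
    (2 + (m + m)) * (1 + (m + m))   ≤⟨ *-monoʳ-≤ (2 + (m + m)) (n≤1+n (1 + (m + m))) ⟩
    (2 + (m + m)) * (2 + (m + m))   ≡⟨ square m ⟩
    4 * (suc m * suc m)             ∎
    where
    square : ∀ x → (2 + (x + x)) * (2 + (x + x)) ≡ 4 * ((1 + x) * (1 + x))
    square = solve-∀
  regroup : ∀ x y z → 4 * (x * x) * (y * (z * z)) ≡ 4 * y * (x * z * (x * z))
  regroup = solve-∀

power≤4^*factorial : ∀ m → m ^ m ≤ 4 ^ m * m !
power≤4^*factorial m = *-cancelʳ-≤ (m ^ m) (4 ^ m * m !) (m !) {{m !≢0}} (begin
  m ^ m * m !           ≤⟨ factorial-lower m m ⟩
  (m + m) !             ≤⟨ central-factorial m ⟩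
  4 ^ m * (m ! * m !)   ≡⟨ *-assoc (4 ^ m) (m !) (m !) ⟨
  4 ^ m * m ! * m !     ∎)
  where open ≤-Reasoning

S-termwise : ∀ m k → S m k * m ! ≤ suc k * m ^ m * k !
S-termwise m zero    = ≤-trans (exponential-term-max m 0) (≤-reflexive (cong (_* 1) (sym (+-identityʳ (m ^ m)))))
S-termwise m (suc k) = begin
  (suc k * S m k + m ^ suc k) * m !                  ≡⟨ distrib (suc k) (S m k) (m ^ suc k) (m !) ⟩
  suc k * (S m k * m !) + m ^ suc k * m !            ≤⟨ +-mono-≤ (*-monoʳ-≤ (suc k) (S-termwise m k))
                                                                 (exponential-term-max m (suc k)) ⟩
  suc k * (suc k * m ^ m * k !) + m ^ m * suc k !    ≡⟨ collect (suc k) (m ^ m) (k !) ⟩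
  suc (suc k) * m ^ m * suc k !                      ∎
  where
  open ≤-Reasoning
  distrib : ∀ a s p f → (a * s + p) * f ≡ a * (s * f) + p * f
  distrib = solve-∀
  collect : ∀ a p f → a * (a * p * f) + p * (a * f) ≡ (1 + a) * p * (a * f)
  collect = solve-∀

S-geometric : ∀ m k → (S m k + 2 * m ^ k) * m ! ≤ (2 * m + 3) * m ^ m * k !
S-geometric m k with k ≤? 2 * m
... | yes k≤2m = begin
  (S m k + 2 * m ^ k) * m !                      ≡⟨ distrib (S m k) (m ^ k) (m !) ⟩
  S m k * m ! + 2 * (m ^ k * m !)                ≤⟨ +-mono-≤ (S-termwise m k)
                                                             (*-monoʳ-≤ 2 (exponential-term-max m k)) ⟩
  suc k * m ^ m * k ! + 2 * (m ^ m * k !)        ≡⟨ collect k (m ^ m) (k !) ⟩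
  (k + 3) * m ^ m * k !                          ≤⟨ *-monoˡ-≤ (k !) (*-monoˡ-≤ (m ^ m) (+-monoˡ-≤ 3 k≤2m)) ⟩
  (2 * m + 3) * m ^ m * k !                      ∎
  where
  open ≤-Reasoning
  distrib : ∀ s p f → (s + 2 * p) * f ≡ s * f + 2 * (p * f)
  distrib = solve-∀
  collect : ∀ k p f → (1 + k) * p * f + 2 * (p * f) ≡ (k + 3) * p * f
  collect = solve-∀
... | no k≰2m with suc k′ ← k | s≤s 2m≤k′ ← ≰⇒> k≰2m = begin
  (suc k′ * S m k′ + m ^ suc k′ + 2 * m ^ suc k′) * m !        ≡⟨ distrib k′ (S m k′) m (m ^ k′) (m !) ⟩
  suc k′ * (S m k′ * m !) + 3 * m * (m ^ k′ * m !)              ≤⟨ +-monoʳ-≤ (suc k′ * (S m k′ * m !))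
                                                                            (*-monoˡ-≤ (m ^ k′ * m !) 3m≤2[1+k′]) ⟩
  suc k′ * (S m k′ * m !) + 2 * suc k′ * (m ^ k′ * m !)         ≡⟨ factor k′ (S m k′) (m ^ k′) (m !) ⟩
  suc k′ * ((S m k′ + 2 * m ^ k′) * m !)                        ≤⟨ *-monoʳ-≤ (suc k′) (S-geometric m k′) ⟩
  suc k′ * ((2 * m + 3) * m ^ m * k′ !)                         ≡⟨ shift k′ (2 * m + 3) (m ^ m) (k′ !) ⟩
  (2 * m + 3) * m ^ m * suc k′ !                                ∎
  where
  open ≤-Reasoning
  3m≤2[1+k′] : 3 * m ≤ 2 * suc k′
  3m≤2[1+k′] = begin
    3 * m               ≤⟨ *-monoˡ-≤ m (n≤1+n 3) ⟩
    4 * m               ≡⟨ *-distribʳ-+ m 2 2 ⟩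
    2 * m + 2 * m       ≤⟨ +-mono-≤ 2m≤k′ 2m≤k′ ⟩
    k′ + k′             ≤⟨ +-mono-≤ (n≤1+n k′) (n≤1+n k′) ⟩
    suc k′ + suc k′     ≡⟨ cong (suc k′ +_) (sym (+-identityʳ (suc k′))) ⟩
    2 * suc k′          ∎
  distrib : ∀ k s m p f → ((1 + k) * s + m * p + 2 * (m * p)) * f ≡ (1 + k) * (s * f) + 3 * m * (p * f)
  distrib = solve-∀
  factor : ∀ k s p f → (1 + k) * (s * f) + 2 * (1 + k) * (p * f) ≡ (1 + k) * ((s + 2 * p) * f)
  factor = solve-∀
  shift : ∀ k a p f → (1 + k) * (a * p * f) ≡ a * p * ((1 + k) * f)
  shift = solve-∀

S-bound : ∀ m k → S m k ≤ (2 * m + 3) * 4 ^ m * k !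
S-bound m k = *-cancelʳ-≤ (S m k) ((2 * m + 3) * 4 ^ m * k !) (m !) {{m !≢0}} (begin
  S m k * m !                            ≤⟨ *-monoˡ-≤ (m !) (m≤m+n (S m k) (2 * m ^ k)) ⟩
  (S m k + 2 * m ^ k) * m !              ≤⟨ S-geometric m k ⟩
  (2 * m + 3) * m ^ m * k !              ≤⟨ *-monoˡ-≤ (k !) (*-monoʳ-≤ (2 * m + 3) (power≤4^*factorial m)) ⟩
  (2 * m + 3) * (4 ^ m * m !) * k !      ≡⟨ regroup (2 * m + 3) (4 ^ m) (m !) (k !) ⟩
  (2 * m + 3) * 4 ^ m * k ! * m !        ∎)
  where
  open ≤-Reasoning
  regroup : ∀ a b c d → a * (b * c) * d ≡ a * b * d * c
  regroup = solve-∀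

LeExp-nonneg⇒bound : ∀ X m → LeExp X (ℤ.+ m) → X ≤ (2 * m + 3) * 4 ^ m
LeExp-nonneg⇒bound X m (k , X*k!≤S) =
  *-cancelʳ-≤ X ((2 * m + 3) * 4 ^ m) (k !) {{k !≢0}} (≤-trans X*k!≤S (S-bound m k))

LeExp-neg⇒zero : ∀ X j → LeExp X -[1+ j ] → X ≡ 0
LeExp-neg⇒zero zero    j _     = refl
LeExp-neg⇒zero (suc X) j small with s≤s () ← small 1

LeExp-⊖⇒≤ : ∀ X d e → 0 < X → LeExp X (d ⊖ e) → e ≤ d
LeExp-⊖⇒≤ X d e 0<X X≤eᵈ⁻ᵉ = ≮⇒≥ λ d<e → <-irrefl refl (subst (0 <_) (negative (d ⊖ e) X≤eᵈ⁻ᵉ (sign-⊖-< d<e)) 0<X)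
  where
  negative : ∀ z → LeExp X z → sign z ≡ Sign.- → X ≡ 0
  negative -[1+ j ] X≤eᶻ _ = LeExp-neg⇒zero X j X≤eᶻ

-- Numerical estimates

all< : (ℕ → Bool) → ℕ → Bool
all< P zero    = true
all< P (suc k) = all< P k ∧ P k

all<-sound : ∀ P k → T (all< P k) → ∀ m → m < k → T (P m)
all<-sound P (suc k) all-P m (s≤s m≤k) with m≤n⇒m<n∨m≡n m≤k
... | inj₁ m<k  = all<-sound P k (proj₁ (T-∧ .to all-P)) m m<k
... | inj₂ refl = proj₂ (T-∧ {all< P k} .to all-P)

-- Offsets are written m + c and literal factors stay on the right: the type checker would unfold
-- c + m into c successors and c * x into c summands.
below-threshold : ∀ m → m < 100 → (2 * m + 3) * 4 ^ m < ((m + 17) * (m + 17)) ^ 16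
below-threshold m m<100 = <ᵇ⇒< _ _ (all<-sound below 100 _ m m<100)
  where
  below : ℕ → Bool
  below m = (2 * m + 3) * 4 ^ m <ᵇ ((m + 17) * (m + 17)) ^ 16

^-shift : ∀ b c e m → b ^ (c * suc m + e) ≡ b ^ (c * m + e) * b ^ c
^-shift b c e m = begin
  b ^ (c * suc m + e)      ≡⟨ cong (b ^_) (shift c e m) ⟩
  b ^ ((c * m + e) + c)    ≡⟨ ^-distribˡ-+-* b (c * m + e) c ⟩
  b ^ (c * m + e) * b ^ c  ∎
  where
  open ≡-Reasoning
  shift : ∀ c e m → c * (1 + m) + e ≡ (c * m + e) + c
  shift = solve-∀

exponential-gap : ∀ m → 100 ≤ m → (2 * m + 3) * 2 ^ (18 * m + 304) ≤ 3 ^ (12 * m + 148)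
exponential-gap (suc m) 100≤1+m with m≤n⇒m<n∨m≡n 100≤1+m
... | inj₂ 100≡1+m = subst (λ m → (2 * m + 3) * 2 ^ (18 * m + 304) ≤ 3 ^ (12 * m + 148)) 100≡1+m (≤ᵇ⇒≤ _ _ _)
... | inj₁ 100<1+m = begin
  (2 * suc m + 3) * 2 ^ (18 * suc m + 304)   ≡⟨ cong ((2 * suc m + 3) *_) (^-shift 2 18 304 m) ⟩
  (2 * suc m + 3) * (X * 2 ^ 18)             ≤⟨ *-monoˡ-≤ (X * 2 ^ 18) growth ⟩
  2 * (2 * m + 3) * (X * 2 ^ 18)             ≡⟨ regroup (2 * m + 3) X (2 ^ 18) ⟩
  (2 * m + 3) * X * (2 * 2 ^ 18)             ≤⟨ *-mono-≤ (exponential-gap m (≤-pred 100<1+m))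
                                                          (≤ᵇ⇒≤ (2 * 2 ^ 18) (3 ^ 12) _) ⟩
  3 ^ (12 * m + 148) * 3 ^ 12                ≡⟨ ^-shift 3 12 148 m ⟨
  3 ^ (12 * suc m + 148)                     ∎
  where
  open ≤-Reasoning
  X : ℕ
  X = 2 ^ (18 * m + 304)
  growth : 2 * suc m + 3 ≤ 2 * (2 * m + 3)
  growth = begin
    2 * suc m + 3              ≡⟨ shift m ⟩
    (2 * m + 3) + 2            ≤⟨ +-monoʳ-≤ (2 * m + 3) (≤-trans (n≤1+n 2) (m≤n+m 3 (2 * m))) ⟩
    (2 * m + 3) + (2 * m + 3)  ≡⟨ cong ((2 * m + 3) +_) (+-identityʳ (2 * m + 3)) ⟨
    2 * (2 * m + 3)            ∎
    where
    shift : ∀ m → 2 * (1 + m) + 3 ≡ (2 * m + 3) + 2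
    shift = solve-∀
  regroup : ∀ a x c → 2 * a * (x * c) ≡ a * x * (2 * c)
  regroup = solve-∀

threshold-reached : ∀ m Δ → m + 17 ≤ Δ → (Δ * (m + 17)) ^ 16 ≤ (2 * m + 3) * 4 ^ m → 100 ≤ m
threshold-reached m Δ d≤Δ Δd-small = ≮⇒≥ λ m<100 → <⇒≱ (below-threshold m m<100) (begin
  ((m + 17) * (m + 17)) ^ 16  ≤⟨ ^-monoˡ-≤ 16 (*-monoˡ-≤ (m + 17) d≤Δ) ⟩
  (Δ * (m + 17)) ^ 16         ≤⟨ Δd-small ⟩
  (2 * m + 3) * 4 ^ m         ∎)
  where open ≤-Reasoning

dependency-bound : ∀ m Δ → m + 17 ≤ Δ → suc (m + 15) * suc Δ ≤ Δ * (m + 17) * 2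
dependency-bound m Δ d≤Δ = begin
  suc (m + 15) * suc Δ             ≤⟨ *-monoˡ-≤ (suc Δ) (≤-trans (≤-reflexive (sym (+-suc m 15))) (+-monoʳ-≤ m (n≤1+n 16)))
                                    ⟩
  (m + 17) * suc Δ                 ≡⟨ *-suc (m + 17) Δ ⟩
  m + 17 + (m + 17) * Δ            ≤⟨ +-monoˡ-≤ ((m + 17) * Δ) (≤-trans d≤Δ (m≤m*n Δ (m + 17) {{>-nonZero 0<d}})) ⟩
  Δ * (m + 17) + (m + 17) * Δ      ≡⟨ cong (Δ * (m + 17) +_) (*-comm (m + 17) Δ) ⟩
  Δ * (m + 17) + Δ * (m + 17)      ≡⟨ double (Δ * (m + 17)) ⟩
  Δ * (m + 17) * 2                 ∎
  where
  open ≤-Reasoning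
  0<d : 0 < m + 17
  0<d = ≤-trans (s≤s z≤n) (m≤n+m 17 m)
  double : ∀ x → x + x ≡ x * 2
  double = solve-∀

numeric-condition : ∀ m Δ t D → 100 ≤ m → D ≤ Δ * (m + 17) * 2 → (Δ * (m + 17)) ^ 16 ≤ (2 * m + 3) * 4 ^ m →
  4 * t ≤ m + 17 + 6 → 8 * D * 3 ^ t * 2 ^ (m + 15) ≤ 3 ^ (m + 15)
numeric-condition m Δ t D 100≤m D≤2Δd Δd-small 4t≤d+6 =
  ^-cancelʳ-≤ 16 (8 * D * 3 ^ t * 2 ^ (m + 15)) (3 ^ (m + 15)) (begin
  (8 * D * 3 ^ t * 2 ^ (m + 15)) ^ 16
    ≡⟨ ^-distribʳ-*³ (8 * D) (3 ^ t) (2 ^ (m + 15)) 16 ⟩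
  (8 * D) ^ 16 * (3 ^ t) ^ 16 * (2 ^ (m + 15)) ^ 16
    ≤⟨ *-mono-≤ (*-mono-≤ 8D-bound 3ᵗ-bound) (≤-reflexive (^-*-assoc 2 (m + 15) 16)) ⟩
  (2 * m + 3) * 2 ^ (2 * m) * 2 ^ 64 * 3 ^ (4 * m + 92) * 2 ^ ((m + 15) * 16)
    ≡⟨ collect-powers-of-2 ⟩
  (2 * m + 3) * 2 ^ (18 * m + 304) * 3 ^ (4 * m + 92)
    ≤⟨ *-monoˡ-≤ (3 ^ (4 * m + 92)) (exponential-gap m 100≤m) ⟩
  3 ^ (12 * m + 148) * 3 ^ (4 * m + 92)
    ≡⟨ collect-powers-of-3 ⟩
  (3 ^ (m + 15)) ^ 16 ∎)
  where
  open ≤-Reasoning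
  ^-distribʳ-*³ : ∀ x y z n → (x * y * z) ^ n ≡ x ^ n * y ^ n * z ^ n
  ^-distribʳ-*³ x y z n = trans (^-distribʳ-* (x * y) z n) (cong (_* z ^ n) (^-distribʳ-* x y n))
  8D-bound : (8 * D) ^ 16 ≤ (2 * m + 3) * 2 ^ (2 * m) * 2 ^ 64
  8D-bound = begin
    (8 * D) ^ 16                            ≤⟨ ^-monoˡ-≤ 16 (*-monoʳ-≤ 8 D≤2Δd) ⟩
    (8 * (Δ * (m + 17) * 2)) ^ 16           ≡⟨ cong (_^ 16) (rearrange (Δ * (m + 17))) ⟩
    (Δ * (m + 17) * 16) ^ 16                ≡⟨ ^-distribʳ-* (Δ * (m + 17)) 16 16 ⟩
    (Δ * (m + 17)) ^ 16 * 16 ^ 16           ≤⟨ *-monoˡ-≤ (16 ^ 16) Δd-small ⟩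
    (2 * m + 3) * 4 ^ m * 16 ^ 16           ≡⟨ cong (λ x → (2 * m + 3) * x * 16 ^ 16) (^-*-assoc 2 2 m) ⟩
    (2 * m + 3) * 2 ^ (2 * m) * 2 ^ 64      ∎
    where
    rearrange : ∀ x → 8 * (x * 2) ≡ x * 16
    rearrange = solve-∀
  3ᵗ-bound : (3 ^ t) ^ 16 ≤ 3 ^ (4 * m + 92)
  3ᵗ-bound = begin
    (3 ^ t) ^ 16                ≡⟨ ^-*-assoc 3 t 16 ⟩
    3 ^ (t * 16)                ≤⟨ ^-monoʳ-≤ 3 (begin
                                     t * 16            ≡⟨ sixteen t ⟩
                                     4 * t * 4         ≤⟨ *-monoˡ-≤ 4 4t≤d+6 ⟩
                                     (m + 17 + 6) * 4  ≡⟨ linear m ⟩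
                                     4 * m + 92        ∎) ⟩
    3 ^ (4 * m + 92)            ∎
    where
    sixteen : ∀ t → t * 16 ≡ 4 * t * 4
    sixteen = solve-∀
    linear : ∀ m → (m + 17 + 6) * 4 ≡ 4 * m + 92
    linear = solve-∀
  collect-powers-of-2 : (2 * m + 3) * 2 ^ (2 * m) * 2 ^ 64 * 3 ^ (4 * m + 92) * 2 ^ ((m + 15) * 16)
                      ≡ (2 * m + 3) * 2 ^ (18 * m + 304) * 3 ^ (4 * m + 92)
  collect-powers-of-2 = begin-equality
    (2 * m + 3) * 2 ^ (2 * m) * 2 ^ 64 * 3 ^ (4 * m + 92) * 2 ^ ((m + 15) * 16)
      ≡⟨ regroup (2 * m + 3) (2 ^ (2 * m)) (2 ^ 64) (3 ^ (4 * m + 92)) (2 ^ ((m + 15) * 16)) ⟩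
    (2 * m + 3) * (2 ^ (2 * m) * 2 ^ 64 * 2 ^ ((m + 15) * 16)) * 3 ^ (4 * m + 92)
      ≡⟨ cong (λ x → (2 * m + 3) * x * 3 ^ (4 * m + 92)) (^-merge₃ 2 (2 * m) 64 ((m + 15) * 16)) ⟩
    (2 * m + 3) * 2 ^ (2 * m + 64 + (m + 15) * 16) * 3 ^ (4 * m + 92)
      ≡⟨ cong (λ e → (2 * m + 3) * 2 ^ e * 3 ^ (4 * m + 92)) (linear m) ⟩
    (2 * m + 3) * 2 ^ (18 * m + 304) * 3 ^ (4 * m + 92) ∎
    where
    regroup : ∀ a x y z w → a * x * y * z * w ≡ a * (x * y * w) * z
    regroup = solve-∀
    linear : ∀ m → 2 * m + 64 + (m + 15) * 16 ≡ 18 * m + 304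
    linear = solve-∀
  collect-powers-of-3 : 3 ^ (12 * m + 148) * 3 ^ (4 * m + 92) ≡ (3 ^ (m + 15)) ^ 16
  collect-powers-of-3 = begin-equality
    3 ^ (12 * m + 148) * 3 ^ (4 * m + 92)  ≡⟨ ^-distribˡ-+-* 3 (12 * m + 148) (4 * m + 92) ⟨
    3 ^ (12 * m + 148 + (4 * m + 92))      ≡⟨ cong (3 ^_) (linear m) ⟩
    3 ^ ((m + 15) * 16)                    ≡⟨ ^-*-assoc 3 (m + 15) 16 ⟨
    (3 ^ (m + 15)) ^ 16                    ∎
    where
    linear : ∀ m → 12 * m + 148 + (4 * m + 92) ≡ (m + 15) * 16
    linear = solve-∀

-- The random partition

module RandomPartition (G : Digraph) (N Δ t : ℕ)
  (out-large : ∀ v → N + 2 ≤ outdeg G v)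
  (in-small : ∀ w → indeg G w ≤ Δ)
  (numeric : 8 * (suc N * suc Δ) * 3 ^ t * 2 ^ N ≤ 3 ^ N)
  (v₁ v₂ : Fin (n G)) (v₁≢v₂ : v₁ ≢ v₂)
  where

  V : Set
  V = Fin (n G)

  colour : (V → Bool) → V → Bool
  colour q w = if ⁅ v₁ ⁆ w then true else if ⁅ v₂ ⁆ w then false else q w

  colour-cong : ∀ q q′ w → q w ≡ q′ w → colour q w ≡ colour q′ w
  colour-cong q q′ w = cong (λ b → if ⁅ v₁ ⁆ w then true else if ⁅ v₂ ⁆ w then false else b)

  eligible : V → V → Bool
  eligible v = (arc G v ∩ ∁ ⁅ v₁ ⁆) ∩ ∁ ⁅ v₂ ⁆

  eligible-large : ∀ v → N ≤ ∣ eligible v ∣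
  eligible-large v = +-cancelʳ-≤ 2 N ∣ eligible v ∣ (begin
    N + 2                          ≤⟨ out-large v ⟩
    outdeg G v                     ≡⟨ count≡∣∣ (arc G v) ⟩
    ∣ arc G v ∣                    ≤⟨ ∣∣-∖⁅⁆ (arc G v) v₁ ⟩
    suc ∣ arc G v ∩ ∁ ⁅ v₁ ⁆ ∣     ≤⟨ s≤s (∣∣-∖⁅⁆ (arc G v ∩ ∁ ⁅ v₁ ⁆) v₂) ⟩
    suc (suc ∣ eligible v ∣)       ≡⟨ +-comm 2 ∣ eligible v ∣ ⟩
    ∣ eligible v ∣ + 2             ∎)
    where open ≤-Reasoning

  -- Taking exactly N eligible out-neighbours keeps the scopes of the bad events small.
  F : V → V → Bool
  F v = proj₁ (subset-of-size (eligible v) (eligible-large v))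

  F⊆eligible : ∀ v → F v ⊆ eligible v
  F⊆eligible v = proj₁ (proj₂ (subset-of-size (eligible v) (eligible-large v)))

  ∣F∣≡N : ∀ v → ∣ F v ∣ ≡ N
  ∣F∣≡N v = proj₂ (proj₂ (subset-of-size (eligible v) (eligible-large v)))

  Few : V → Bool → (V → Bool) → Bool
  Few v c q = ∣ F v ∩ (λ w → q w == c) ∣ <ᵇ t

  Bad : V → (V → Bool) → Bool
  Bad v q = Few v (colour q v) q

  scope : V → V → Bool
  scope v = ⁅ v ⁆ ∪ F v

  Bad-determined : ∀ v → DeterminedBy (scope v) (Bad v)
  Bad-determined v q q′ agree = cong (_<ᵇ t) (∣∣-cong same)
    where
    colour-v : colour q v ≡ colour q′ v
    colour-v = colour-cong q q′ v (agree v (T-∨ .from (inj₁ (fromWitness {a? = v ≟ v} refl))))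
    same : ∀ w → F v w ∧ (q w == colour q v) ≡ F v w ∧ (q′ w == colour q′ v)
    same w with F v w in w∈F
    ... | false = refl
    ... | true  = cong₂ _==_ (agree w (T-∨ {⁅ v ⁆ w} .from (inj₂ (T-≡ .from w∈F)))) colour-v

  sparse : ∀ i → ∣ (λ j → overlaps (scope i) (scope j)) ∣ ≤ suc N * suc Δ
  sparse i = ≤-trans (overlap-count scope i (suc Δ) degree) (*-monoˡ-≤ (suc Δ) size)
    where
    size : ∣ scope i ∣ ≤ suc N
    size = ≤-trans (∣∣-∪ ⁅ i ⁆ (F i)) (+-mono-≤ (∣⁅⁆∣≤1 i) (≤-reflexive (∣F∣≡N i)))
    degree : ∀ x → ∣ (λ j → scope j x) ∣ ≤ suc Δ
    degree x = ≤-trans (∣∣-∪ (λ j → ⁅ j ⁆ x) (λ j → F j x)) (+-mono-≤ at-most-one (≤-trans into-x (in-small x)))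
      where
      at-most-one : ∣ (λ j → ⁅ j ⁆ x) ∣ ≤ 1
      at-most-one = ∣∣≤1 (λ j → ⁅ j ⁆ x) (λ j≡x k≡x → trans (toWitness j≡x) (sym (toWitness k≡x)))
      into-x : ∣ (λ j → F j x) ∣ ≤ indeg G x
      into-x = ≤-trans (∣∣-mono (λ j → F j x) (λ j → arc G j x) (λ j x∈Fj →
                 proj₁ (T-∧ .to (proj₁ (T-∧ .to (F⊆eligible j x x∈Fj))))))
               (≤-reflexive (sym (count≡∣∣ (λ j → arc G j x))))

  D : ℕ
  D = suc N * suc Δ

  Bad⊆Few : ∀ v → Bad v ⊆ Few v true ∪ Few v false
  Bad⊆Few v q bad with colour q v
  ... | true  = T-∨ .from (inj₁ bad)
  ... | false = T-∨ {Few v true q} .from (inj₂ bad)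

  Few-rare : ∀ v c → #sat (Few v c) * 3 ^ N ≤ 2 ^ n G * 3 ^ t * 2 ^ N
  Few-rare v c =
    subst (λ K → #sat (Few v c) * 3 ^ K ≤ 2 ^ n G * 3 ^ t * 2 ^ K) (∣F∣≡N v) (random-colour-tail (F v) c t)

  rare : ∀ v → 4 * D * #sat (Bad v) ≤ 2 ^ n G
  rare v = *-cancelʳ-≤ (4 * D * #sat (Bad v)) (2 ^ n G) (3 ^ N) {{m^n≢0 3 N}} (begin
    4 * D * #sat (Bad v) * 3 ^ N                              ≤⟨ *-monoˡ-≤ (3 ^ N) (*-monoʳ-≤ (4 * D) Bad≤Few) ⟩
    4 * D * (#sat (Few v true) + #sat (Few v false)) * 3 ^ N
      ≡⟨ distrib (4 * D) (#sat (Few v true)) (#sat (Few v false)) (3 ^ N) ⟩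
    4 * D * (#sat (Few v true) * 3 ^ N + #sat (Few v false) * 3 ^ N)
      ≤⟨ *-monoʳ-≤ (4 * D) (+-mono-≤ (Few-rare v true) (Few-rare v false)) ⟩
    4 * D * (2 ^ n G * 3 ^ t * 2 ^ N + 2 ^ n G * 3 ^ t * 2 ^ N)  ≡⟨ regroup D (2 ^ n G) (3 ^ t) (2 ^ N) ⟩
    2 ^ n G * (8 * D * 3 ^ t * 2 ^ N)                         ≤⟨ *-monoʳ-≤ (2 ^ n G) numeric ⟩
    2 ^ n G * 3 ^ N                                           ∎)
    where
    open ≤-Reasoning
    Bad≤Few : #sat (Bad v) ≤ #sat (Few v true) + #sat (Few v false)
    Bad≤Few = ≤-trans (#sat-mono (Bad v) (Few v true ∪ Few v false) (Bad⊆Few v)) (#sat-∪ (Few v true) (Few v false))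
    distrib : ∀ a x y z → a * (x + y) * z ≡ a * (x * z + y * z)
    distrib = solve-∀
    regroup : ∀ d a b c → 4 * d * (a * b * c + a * b * c) ≡ a * (8 * d * b * c)
    regroup = solve-∀

  open LovászLocalLemma Bad scope Bad-determined D sparse rare

  colour-outside : ∀ q w → ¬ T (⁅ v₁ ⁆ w) → ¬ T (⁅ v₂ ⁆ w) → colour q w ≡ q w
  colour-outside q w w≢v₁ w≢v₂ rewrite ¬T⇒≡false w≢v₁ | ¬T⇒≡false w≢v₂ = refl

  colour-v₁ : ∀ q → colour q v₁ ≡ true
  colour-v₁ q rewrite T-≡ .to (fromWitness {a? = v₁ ≟ v₁} refl) = refl

  colour-v₂ : ∀ q → colour q v₂ ≡ false
  colour-v₂ q
    rewrite ¬T⇒≡false {⁅ v₁ ⁆ v₂} (λ v₁≡v₂ → v₁≢v₂ (toWitness v₁≡v₂))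
          | T-≡ .to (fromWitness {a? = v₂ ≟ v₂} refl)
          = refl

  friendly-partition : Σ (V → Bool) λ p → p v₁ ≡ true × p v₂ ≡ false × (∀ v → t ≤ ownOut G p v)
  friendly-partition = colour q , colour-v₁ q , colour-v₂ q , friendly
    where
    q : V → Bool
    q = proj₁ lovász-local-lemma
    friendly : ∀ v → t ≤ ownOut G (colour q) v
    friendly v = begin
      t                                                 ≤⟨ ≮⇒≥ (λ few → proj₂ lovász-local-lemma v (<⇒<ᵇ few)) ⟩
      ∣ F v ∩ (λ w → q w == colour q v) ∣               ≤⟨ ∣∣-mono _ _ own ⟩
      ∣ arc G v ∩ (λ w → colour q w == colour q v) ∣    ≡⟨ count≡∣∣ (arc G v ∩ (λ w → colour q w == colour q v)) ⟨
      ownOut G (colour q) v                             ∎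
      where
      open ≤-Reasoning
      own : F v ∩ (λ w → q w == colour q v) ⊆ arc G v ∩ (λ w → colour q w == colour q v)
      own w w∈F∩same =
        let w∈F , same = T-∧ .to w∈F∩same
            arc-v₁ , w≢v₂ = T-∧ .to (F⊆eligible v w w∈F)
            arc , w≢v₁ = T-∧ .to arc-v₁
            q≡colour = colour-outside q w (T-not⇒¬T w≢v₁) (T-not⇒¬T w≢v₂)
        in T-∧ .from (arc , subst (λ b → T (b == colour q v)) (sym q≡colour) same)

quarter-ceiling : ∀ a → ∃ λ t → a ≤ 4 * t × 4 * t ≤ a + 3
quarter-ceiling a = t , lower , upper
  where
  t r : ℕ
  t = (a + 3) / 4
  r = (a + 3) % 4
  a+3≡r+4t : a + 3 ≡ r + 4 * t
  a+3≡r+4t = trans (m≡m%n+[m/n]*n (a + 3) 4) (cong (r +_) (*-comm t 4))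
  lower : a ≤ 4 * t
  lower = +-cancelʳ-≤ 3 a (4 * t) (begin
    a + 3        ≡⟨ a+3≡r+4t ⟩
    r + 4 * t    ≤⟨ +-monoˡ-≤ (4 * t) (≤-pred (m%n<n (a + 3) 4)) ⟩
    3 + 4 * t    ≡⟨ +-comm 3 (4 * t) ⟩
    4 * t + 3    ∎)
    where open ≤-Reasoning
  upper : 4 * t ≤ a + 3
  upper = ≤-trans (m≤n+m (4 * t) r) (≤-reflexive (sym a+3≡r+4t))

min-outdeg≤max-indeg : ∀ (G : Digraph) d Δ → Fin (n G) → (∀ v → d ≤ outdeg G v) → (∀ w → indeg G w ≤ Δ) → d ≤ Δ
min-outdeg≤max-indeg G d Δ v outdeg≥d indeg≤Δ = *-cancelˡ-≤ (n G) {{Fin.nonZeroIndex v}} (begin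
  n G * d                                ≡⟨ ∑-const (n G) d ⟨
  ∑[ v < n G ] d                         ≤⟨ ∑-mono (λ v → subst (d ≤_) (count≡∣∣ (arc G v)) (outdeg≥d v)) ⟩
  ∑[ v < n G ] ∣ arc G v ∣               ≡⟨ ∑-comm (λ v w → 𝟙 (arc G v w)) ⟩
  ∑[ w < n G ] ∣ (λ v → arc G v w) ∣     ≤⟨ ∑-mono (λ w → subst (_≤ Δ) (count≡∣∣ (λ v → arc G v w)) (indeg≤Δ w)) ⟩
  ∑[ w < n G ] Δ                         ≡⟨ ∑-const (n G) Δ ⟩
  n G * Δ                                ∎)
  where open ≤-Reasoning

separating-friendly : ∀ (G : Digraph) a t (p : Fin (n G) → Bool) {v₁ v₂} → a ≤ 4 * t →
  p v₁ ≡ true → p v₂ ≡ false → (∀ v → t ≤ ownOut G p v) → FriendlyQuarter G a p × p v₁ ≢ p v₂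
separating-friendly G a t p {v₁} {v₂} a≤4t p₁ p₂ friendly =
  (((v₁ , p₁) , (v₂ , p₂)) , λ v → ≤-trans a≤4t (*-monoʳ-≤ 4 (friendly v))) ,
  λ p₁≡p₂ → true≢false (trans (sym p₁) (trans p₁≡p₂ p₂))
  where
  true≢false : true ≢ false
  true≢false ()

friendly-partition-exists : ∀ (G : Digraph) m d Δ → m + 17 ≡ d → (∀ v → d ≤ outdeg G v) → (∀ w → indeg G w ≤ Δ) →
  d ≤ Δ → LeExp ((Δ * d) ^ 16) (d ⊖ 17) →
  (v₁ v₂ : Fin (n G)) → v₁ ≢ v₂ → Σ (Fin (n G) → Bool) λ p → FriendlyQuarter G (d + 3) p × p v₁ ≢ p v₂
friendly-partition-exists G m .(m + 17) Δ refl outdeg≥d indeg≤Δ d≤Δ Δd≤eᵐ v₁ v₂ v₁≢v₂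
  with t , d+3≤4t , 4t≤d+6 ← quarter-ceiling (m + 17 + 3)
  = result (RandomPartition.friendly-partition G (m + 15) Δ t out-large indeg≤Δ numeric v₁ v₂ v₁≢v₂)
  where
  out-large : ∀ v → m + 15 + 2 ≤ outdeg G v
  out-large v = subst (_≤ outdeg G v) (sym (+-assoc m 15 2)) (outdeg≥d v)
  Δd-small : (Δ * (m + 17)) ^ 16 ≤ (2 * m + 3) * 4 ^ m
  Δd-small = LeExp-nonneg⇒bound _ m (subst (LeExp _) (trans (⊖-≥ (m≤n+m 17 m)) (cong ℤ.+_ (m+n∸n≡m m 17))) Δd≤eᵐ)
  numeric : 8 * (suc (m + 15) * suc Δ) * 3 ^ t * 2 ^ (m + 15) ≤ 3 ^ (m + 15)
  numeric = numeric-condition m Δ t (suc (m + 15) * suc Δ)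
    (threshold-reached m Δ d≤Δ Δd-small) (dependency-bound m Δ d≤Δ) Δd-small
    (≤-trans 4t≤d+6 (≤-reflexive (+-assoc (m + 17) 3 3)))
  result : Σ (Fin (n G) → Bool) (λ p → p v₁ ≡ true × p v₂ ≡ false × (∀ v → t ≤ ownOut G p v)) →
           Σ (Fin (n G) → Bool) λ p → FriendlyQuarter G (m + 17 + 3) p × p v₁ ≢ p v₂
  result (p , p₁ , p₂ , friendly) = p , separating-friendly G (m + 17 + 3) t p d+3≤4t p₁ p₂ friendly

theorem1p11 : (G : Digraph) (d : ℕ) → 1 ≤ d
    → ((v : Fin (n G)) → d ≤ outdeg G v)
    → ((v : Fin (n G)) → LeExp ((indeg G v * d) ^ 16) (d ⊖ 17))
    → (v₁ v₂ : Fin (n G)) → v₁ ≢ v₂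
    → Σ (Fin (n G) → Bool) λ p → FriendlyQuarter G (d + 3) p × p v₁ ≢ p v₂
theorem1p11 G d 1≤d outdeg≥d indeg-small v₁ v₂ v₁≢v₂ =
  let w , indeg≤max = argmax v₁ (indeg G)
      d≤Δ  = min-outdeg≤max-indeg G d (indeg G w) v₁ outdeg≥d indeg≤max
      17≤d = LeExp-⊖⇒≤ _ d 17 (^-monoˡ-≤ 16 (*-mono-≤ (≤-trans 1≤d d≤Δ) 1≤d)) (indeg-small w)
  in friendly-partition-exists G (d ∸ 17) d (indeg G w) (m∸n+n≡m 17≤d)
       outdeg≥d indeg≤max d≤Δ (indeg-small w) v₁ v₂ v₁≢v₂
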